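{- Let $A$ be a vertex of $H_{\aleph_0}$, let $H(A)$ be the connected component of $H_{\aleph_0}$ containing $A$, and let $f$ be the restriction to $H(A)$ of an automorphism of $H_{\aleph_0}$. Then for every $X\in H(A)$ there exists a symplectic permutation $s_X$ of $\mathbb{Z}\setminus\{0\}$ such that $f(Y)=s_X(Y)$ for all $Y\in X^{\sim}$, where $X^{\sim}$ denotes the set consisting of $X$ and all vertices of $H_{\aleph_0}$ adjacent to $X$.
   Context: A subset $X\subset\mathbb{Z}\setminus\{0\}$ is called singular if $i\in X$ implies $-i\notin X$; a maximal singular subset is one containing exactly one of $i,-i$ for every natural $i$. Two maximal singular subsets $X,Y$ are adjacent if $|X\setminus Y|=|Y\setminus X|=1$. The graph $H_{\aleph_0}$ has as vertices all maximal singular subsets of $\mathbb{Z}\setminus\{0\}$ and as edges the adjacent pairs. A permutation $s$ of $\mathbb{Z}\setminus\{0\}$ is symplectic if $s(-i)=-s(i)$ for all $i$; it maps maximal singular subsets to maximal singular subsets. -}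

module Defs where

open import Data.Bool using (Bool; true; false; not)
open import Data.Nat using (ℕ; zero; suc)
open import Data.Integer using (ℤ; +_; -[1+_]; +[1+_]; NonZero)
open import Data.Product using (Σ; ∃; _×_; _,_; proj₁)
open import Data.Sum using (_⊎_)
open import Function.Bundles using (_↔_; Inverse)
open import Relation.Binary.PropositionalEquality using (_≡_)

NZ : Set
NZ = Σ ℤ NonZero

neg : NZ → NZ
neg (+ zero , ())
neg (+[1+ n ] , _) = -[1+ n ] , _
neg (-[1+ n ] , _) = +[1+ n ] , _

Subset : Set
Subset = NZ → Bool

_∈_ : NZ → Subset → Set
i ∈ X = X i ≡ true

_∉_ : NZ → Subset → Set
i ∉ X = X i ≡ false

MaximalSingular : Subset → Set
MaximalSingular X = ∀ i → X (neg i) ≡ not (X i)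

Vertex : Set
Vertex = Σ Subset MaximalSingular

set : Vertex → Subset
set = proj₁

_≈_ : Vertex → Vertex → Set
X ≈ Y = ∀ i → set X i ≡ set Y i

DiffOne : Subset → Subset → Set
DiffOne X Y = ∃ λ z → z ∈ X × z ∉ Y × (∀ w → w ∈ X → w ∉ Y → w ≡ z)

Adjacent : Vertex → Vertex → Set
Adjacent X Y = DiffOne (set X) (set Y) × DiffOne (set Y) (set X)

data InComponent (A : Vertex) : Vertex → Set where
  here : InComponent A A
  step : ∀ {X Y} → InComponent A X → Adjacent X Y → InComponent A Y

InTilde : Vertex → Vertex → Set
InTilde X Y = (Y ≈ X) ⊎ Adjacent X Y

record Automorphism : Set where
  field
    f         : Vertex → Vertex
    f-cong    : ∀ {X Y} → X ≈ Y → f X ≈ f Y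
    f-inj     : ∀ {X Y} → f X ≈ f Y → X ≈ Y
    f-surj    : ∀ Y → ∃ λ X → f X ≈ Y
    f-adj     : ∀ {X Y} → Adjacent X Y → Adjacent (f X) (f Y)
    f-adj⁻¹   : ∀ {X Y} → Adjacent (f X) (f Y) → Adjacent X Y

Symplectic : NZ ↔ NZ → Set
Symplectic s = ∀ i → Inverse.to s (neg i) ≡ neg (Inverse.to s i)

-- Image s(Y) = { s y | y ∈ Y } : i ∈ s(Y) iff s⁻¹(i) ∈ Y.
image : NZ ↔ NZ → Subset → Subset
image s Y i = Y (Inverse.from s i)

-- The neighbours of a vertex V are exactly the vertices flip V k obtained by
-- exchanging k and -k, and flip V k depends only on the pair {k, -k}.  An
-- automorphism f therefore induces a bijection between the pairs flipped around X
-- and those flipped around f X, namely f (flip X k) = flip (f X) (g k).  Sending i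
-- to the element of the pair g i whose membership in f X agrees with that of i in
-- X gives a symplectic permutation s with s X = f X, and since a symplectic
-- permutation commutes with flips, s (flip X k) = flip (f X) (s k) = f (flip X k).
module Submission where

open import Defs
open import Data.Bool as Bool using (Bool; true; false; not; _xor_)
open import Data.Bool.Properties using (not-¬; ¬-not; not-distribʳ-xor; xor-assoc; xor-same)
open import Data.Integer using (-[1+_]; +[1+_]; ∣_∣)
open import Data.Nat as ℕ using (ℕ)
open import Data.Product using (∃; _×_; _,_; proj₁; proj₂; map₂)
open import Data.Sum using (_⊎_; inj₁; inj₂)
open import Function using (_∘_)
open import Function.Bundles using (_↔_; Inverse; mk↔ₛ′; mk⇔)
open import Relation.Binary.PropositionalEquality
open import Relation.Nullary using (does; yes; no; contradiction)
open import Relation.Nullary.Decidable using (dec-true; dec-false; does-⇔)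

pair : NZ → ℕ
pair (i , _) = ∣ i ∣

pair-neg : ∀ i → pair (neg i) ≡ pair i
pair-neg (+[1+ n ] , _) = refl
pair-neg (-[1+ n ] , _) = refl

pair-injective : ∀ i j → pair i ≡ pair j → i ≡ j ⊎ i ≡ neg j
pair-injective (+[1+ m ] , _) (+[1+ .m ] , _) refl = inj₁ refl
pair-injective (+[1+ m ] , _) (-[1+ .m ] , _) refl = inj₂ refl
pair-injective (-[1+ m ] , _) (+[1+ .m ] , _) refl = inj₂ refl
pair-injective (-[1+ m ] , _) (-[1+ .m ] , _) refl = inj₁ refl

samePair-sameMembership⇒≡ : ∀ (V : Vertex) {i j} →
  pair i ≡ pair j → set V i ≡ set V j → i ≡ j
samePair-sameMembership⇒≡ (V , maximal) {i} {j} p e with pair-injective i j p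
... | inj₁ i≡j = i≡j
... | inj₂ refl = contradiction (trans (sym e) (maximal j)) (not-¬ refl)

pick : Vertex → Bool → NZ → NZ
pick V b a with set V a Bool.≟ b
... | yes _ = a
... | no _ = neg a

pair-pick : ∀ V b a → pair (pick V b a) ≡ pair a
pair-pick V b a with set V a Bool.≟ b
... | yes _ = refl
... | no _ = pair-neg a

set-pick : ∀ V b a → set V (pick V b a) ≡ b
set-pick V b a with set V a Bool.≟ b
... | yes Va≡b = Va≡b
... | no Va≢b = trans (proj₂ V a) (sym (¬-not (Va≢b ∘ sym)))

flipSet : Subset → NZ → Subset
flipSet P k m = does (pair m ℕ.≟ pair k) xor P m

flip-maximalSingular : ∀ V k → MaximalSingular (flipSet (set V) k)
flip-maximalSingular (V , maximal) k m rewrite pair-neg m | maximal m =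
  sym (not-distribʳ-xor (does (pair m ℕ.≟ pair k)) (V m))

flip : Vertex → NZ → Vertex
flip V k = flipSet (set V) k , flip-maximalSingular V k

flip-near : ∀ V k m → pair m ≡ pair k → set (flip V k) m ≡ not (set V m)
flip-near V k m p = cong (_xor set V m) (dec-true (pair m ℕ.≟ pair k) p)

flip-apart : ∀ V k m → pair m ≢ pair k → set (flip V k) m ≡ set V m
flip-apart V k m p = cong (_xor set V m) (dec-false (pair m ℕ.≟ pair k) p)

flip-cong : ∀ V k k′ → pair k ≡ pair k′ → flip V k ≈ flip V k′
flip-cong V k k′ p m = cong (λ n → does (pair m ℕ.≟ n) xor set V m) p

flip-injective : ∀ V k k′ → flip V k ≈ flip V k′ → pair k ≡ pair k′
flip-injective V k k′ e with pair k ℕ.≟ pair k′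
... | yes p = p
... | no ¬p = contradiction
  (trans (sym (flip-apart V k′ k ¬p)) (trans (sym (e k)) (flip-near V k k refl))) (not-¬ refl)

flip-involutive : ∀ V k → flip (flip V k) k ≈ V
flip-involutive V k m = trans (sym (xor-assoc d d (set V m))) (cong (_xor set V m) (xor-same d))
  where d = does (pair m ℕ.≟ pair k)

diffOne-resp : ∀ {P P′ Q Q′ : Subset} → (∀ m → P m ≡ P′ m) → (∀ m → Q m ≡ Q′ m) →
  DiffOne P Q → DiffOne P′ Q′
diffOne-resp P≐P′ Q≐Q′ (z , z∈P , z∉Q , unique) =
  z , trans (sym (P≐P′ z)) z∈P , trans (sym (Q≐Q′ z)) z∉Q ,
  λ w w∈P′ w∉Q′ → unique w (trans (P≐P′ w) w∈P′) (trans (Q≐Q′ w) w∉Q′)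

adjacent-resp : ∀ {U U′ V V′} → U ≈ U′ → V ≈ V′ → Adjacent U V → Adjacent U′ V′
adjacent-resp U≈U′ V≈V′ (U∖V , V∖U) =
  diffOne-resp U≈U′ V≈V′ U∖V , diffOne-resp V≈V′ U≈U′ V∖U

diffOne-flip : ∀ V k → DiffOne (set V) (set (flip V k))
diffOne-flip V k = z , set-pick V true k , z∉flip , unique
  where
  z = pick V true k
  z∉flip : set (flip V k) z ≡ false
  z∉flip = trans (flip-near V k z (pair-pick V true k)) (cong not (set-pick V true k))
  unique : ∀ w → set V w ≡ true → set (flip V k) w ≡ false → w ≡ z
  unique w w∈V w∉flip with pair w ℕ.≟ pair k
  ... | yes p = samePair-sameMembership⇒≡ V (trans p (sym (pair-pick V true k)))
                                            (trans w∈V (sym (set-pick V true k)))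
  ... | no ¬p = contradiction (trans (sym (flip-apart V k w ¬p)) w∉flip) (not-¬ w∈V)

adjacent-flip : ∀ V k → Adjacent V (flip V k)
adjacent-flip V k =
  diffOne-flip V k , diffOne-resp (λ _ → refl) (flip-involutive V k) (diffOne-flip (flip V k) k)

≈flip⇒adjacent : ∀ U V k → V ≈ flip U k → Adjacent U V
≈flip⇒adjacent U V k V≈flip =
  adjacent-resp {U} {U} {flip U k} {V} (λ _ → refl) (λ m → sym (V≈flip m)) (adjacent-flip U k)

diffOne⇒≈flip : ∀ U V → DiffOne (set U) (set V) → ∃ λ k → V ≈ flip U k
diffOne⇒≈flip U V (z , z∈U , z∉V , unique) = z , λ m → sym (agree m)
  where
  near : ∀ m → pair m ≡ pair z → not (set U m) ≡ set V m
  near m p with pair-injective m z p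
  ... | inj₁ refl = trans (cong not z∈U) (sym z∉V)
  ... | inj₂ refl = trans (cong not (trans (proj₂ U z) (cong not z∈U)))
                          (sym (trans (proj₂ V z) (cong not z∉V)))
  apart : ∀ m → pair m ≢ pair z → set U m ≡ set V m
  apart m ¬p with set U m in Um | set V m in Vm
  ... | true  | true  = refl
  ... | false | false = refl
  ... | true  | false = contradiction (cong pair (unique m Um Vm)) ¬p
  ... | false | true  = contradiction
    (trans (sym (pair-neg m)) (cong pair (unique (neg m) (trans (proj₂ U m) (cong not Um))
                                                         (trans (proj₂ V m) (cong not Vm)))))
    ¬p
  agree : ∀ m → set (flip U z) m ≡ set V m
  agree m with pair m ℕ.≟ pair z
  ... | yes p = trans (flip-near U z m p) (near m p)
  ... | no ¬p = trans (flip-apart U z m ¬p) (apart m ¬p)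

module _ (s : NZ ↔ NZ) (symplectic : Symplectic s) where
  open Inverse s

  to-injective : ∀ {i j} → to i ≡ to j → i ≡ j
  to-injective {i} {j} e =
    trans (sym (strictlyInverseʳ i)) (trans (cong from e) (strictlyInverseʳ j))

  to-samePair : ∀ i j → pair i ≡ pair j → pair (to i) ≡ pair (to j)
  to-samePair i j p with pair-injective i j p
  ... | inj₁ refl = refl
  ... | inj₂ refl = trans (cong pair (symplectic j)) (pair-neg (to j))

  to-samePair⁻¹ : ∀ i j → pair (to i) ≡ pair (to j) → pair i ≡ pair j
  to-samePair⁻¹ i j p with pair-injective (to i) (to j) p
  ... | inj₁ e = cong pair (to-injective e)
  ... | inj₂ e = trans (cong pair (to-injective (trans e (sym (symplectic j))))) (pair-neg j)

  image-flip : ∀ V k i →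
    image s (set (flip V k)) i ≡ does (pair i ℕ.≟ pair (to k)) xor image s (set V) i
  image-flip V k i = cong (_xor set V (from i))
    (does-⇔ (mk⇔ forward backward) (pair (from i) ℕ.≟ pair k) (pair i ℕ.≟ pair (to k)))
    where
    forward : pair (from i) ≡ pair k → pair i ≡ pair (to k)
    forward p = trans (cong pair (sym (strictlyInverseˡ i))) (to-samePair (from i) k p)
    backward : pair i ≡ pair (to k) → pair (from i) ≡ pair k
    backward q = to-samePair⁻¹ (from i) k (trans (cong pair (strictlyInverseˡ i)) q)

module Induced (F : Automorphism) (X : Vertex) where
  open Automorphism F

  record Corresponds (k j : NZ) : Set where
    constructor corresponds
    field flips : f (flip X k) ≈ flip (f X) j
  open Corresponds

  corresponds-respˡ : ∀ {k k′ j} → pair k ≡ pair k′ → Corresponds k j → Corresponds k′ j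
  corresponds-respˡ {k} {k′} p c =
    corresponds λ m → trans (f-cong (flip-cong X k′ k (sym p)) m) (flips c m)

  corresponds-respʳ : ∀ {k j j′} → pair j ≡ pair j′ → Corresponds k j → Corresponds k j′
  corresponds-respʳ {j = j} {j′} p c =
    corresponds λ m → trans (flips c m) (flip-cong (f X) j j′ p m)

  corresponds-functional : ∀ {k j j′} → Corresponds k j → Corresponds k j′ → pair j ≡ pair j′
  corresponds-functional {j = j} {j′} c c′ =
    flip-injective (f X) j j′ (λ m → trans (sym (flips c m)) (flips c′ m))

  corresponds-injective : ∀ {k k′ j} → Corresponds k j → Corresponds k′ j → pair k ≡ pair k′
  corresponds-injective {k} {k′} c c′ =
    flip-injective X k k′ (f-inj (λ m → trans (flips c m) (sym (flips c′ m))))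

  corresponds-total : ∀ k → ∃ (Corresponds k)
  corresponds-total k =
    map₂ corresponds (diffOne⇒≈flip (f X) (f (flip X k)) (proj₁ (f-adj (adjacent-flip X k))))

  corresponds-surjective : ∀ j → ∃ λ k → Corresponds k j
  corresponds-surjective j with f-surj (flip (f X) j)
  ... | W , fW≈flip with diffOne⇒≈flip X W (proj₁ (f-adj⁻¹ (≈flip⇒adjacent (f X) (f W) j fW≈flip)))
  ... | k , W≈flip = k , corresponds λ m → trans (f-cong (λ n → sym (W≈flip n)) m) (fW≈flip m)

  s t : NZ → NZ
  s i = pick (f X) (set X i) (proj₁ (corresponds-total i))
  t j = pick X (set (f X) j) (proj₁ (corresponds-surjective j))

  corresponds-s : ∀ i → Corresponds i (s i)
  corresponds-s i =
    corresponds-respʳ (sym (pair-pick (f X) (set X i) _)) (proj₂ (corresponds-total i))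

  corresponds-t : ∀ j → Corresponds (t j) j
  corresponds-t j =
    corresponds-respˡ (sym (pair-pick X (set (f X) j) _)) (proj₂ (corresponds-surjective j))

  set-s : ∀ i → set (f X) (s i) ≡ set X i
  set-s i = set-pick (f X) (set X i) _

  set-t : ∀ j → set X (t j) ≡ set (f X) j
  set-t j = set-pick X (set (f X) j) _

  s-t : ∀ j → s (t j) ≡ j
  s-t j = samePair-sameMembership⇒≡ (f X)
    (corresponds-functional (corresponds-s (t j)) (corresponds-t j)) (trans (set-s (t j)) (set-t j))

  t-s : ∀ i → t (s i) ≡ i
  t-s i = samePair-sameMembership⇒≡ X
    (corresponds-injective (corresponds-t (s i)) (corresponds-s i)) (trans (set-t (s i)) (set-s i))

  perm : NZ ↔ NZ
  perm = mk↔ₛ′ s t s-t t-s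

  perm-symplectic : Symplectic perm
  perm-symplectic i = samePair-sameMembership⇒≡ (f X) samePair sameMembership
    where
    samePair : pair (s (neg i)) ≡ pair (neg (s i))
    samePair = corresponds-functional {j′ = neg (s i)} (corresponds-s (neg i))
      (corresponds-respˡ (sym (pair-neg i)) (corresponds-respʳ (sym (pair-neg (s i))) (corresponds-s i)))
    sameMembership : set (f X) (s (neg i)) ≡ set (f X) (neg (s i))
    sameMembership = begin
      set (f X) (s (neg i))     ≡⟨ set-s (neg i) ⟩
      set X (neg i)             ≡⟨ proj₂ X i ⟩
      not (set X i)             ≡⟨ cong not (set-s i) ⟨
      not (set (f X) (s i))     ≡⟨ proj₂ (f X) (s i) ⟨
      set (f X) (neg (s i))     ∎
      where open ≡-Reasoning

  image-perm : ∀ i → set (f X) i ≡ image perm (set X) i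
  image-perm i = sym (set-t i)

  image-perm-flip : ∀ k i → set (f (flip X k)) i ≡ image perm (set (flip X k)) i
  image-perm-flip k i = begin
    set (f (flip X k)) i                        ≡⟨ flips (corresponds-s k) i ⟩
    near i xor set (f X) i                      ≡⟨ cong (near i xor_) (image-perm i) ⟩
    near i xor image perm (set X) i             ≡⟨ image-flip perm perm-symplectic X k i ⟨
    image perm (set (flip X k)) i               ∎
    where
    open ≡-Reasoning
    near : NZ → Bool
    near m = does (pair m ℕ.≟ pair (s k))

  image-perm-neighbourhood : ∀ Y → InTilde X Y → ∀ i → set (f Y) i ≡ image perm (set Y) i
  image-perm-neighbourhood Y (inj₁ Y≈X) i =
    trans (f-cong Y≈X i) (trans (image-perm i) (sym (Y≈X (t i))))
  image-perm-neighbourhood Y (inj₂ X~Y) i with diffOne⇒≈flip X Y (proj₁ X~Y)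
  ... | k , Y≈flip = trans (f-cong Y≈flip i) (trans (image-perm-flip k i) (sym (Y≈flip (t i))))

lemma1 : (A : Vertex) (F : Automorphism) (X : Vertex) → InComponent A X →
    ∃ λ (s : NZ ↔ NZ) → Symplectic s ×
    (∀ Y → InTilde X Y →
    ∀ i → set (Automorphism.f F Y) i ≡ image s (set Y) i)
lemma1 A F X _ = perm , perm-symplectic , image-perm-neighbourhood
  where open Induced F X
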